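{- Let $\gamma(T)$ denote the size of a smallest string attractor of $T$, over an alphabet with as many characters as needed. Then: (substitutions) $\liminf_{n\to\infty}\mathsf{MS}_{\mathrm{sub}}(\gamma,n)\ge 2$; moreover $\mathsf{AS}_{\mathrm{sub}}(\gamma,n)\ge \gamma-2$ and $\mathsf{AS}_{\mathrm{sub}}(\gamma,n)=\Omega(\sqrt n)$, i.e. there is a constant $c>0$ and strings $T$ of arbitrarily large length $n$ with $\gamma(T)$ arbitrarily large, each with some $T'$ of length $n$ and $\mathsf{ed}(T,T')=1$, such that $\gamma(T')-\gamma(T)\ge \gamma(T)-2$ and $\gamma(T')-\gamma(T)\ge c\sqrt n$; (insertions) $\liminf_{n\to\infty}\mathsf{MS}_{\mathrm{ins}}(\gamma,n)\ge 2$, $\mathsf{AS}_{\mathrm{ins}}(\gamma,n)\ge\gamma-2$ and $\mathsf{AS}_{\mathrm{ins}}(\gamma,n)=\Omega(\sqrt n)$ (in the same sense, with $|T'|=n+1$); (deletions) $\liminf_{n\to\infty}\mathsf{MS}_{\mathrm{del}}(\gamma,n)\ge 2$, $\mathsf{AS}_{\mathrm{del}}(\gamma,n)\ge\gamma-3$ and $\mathsf{AS}_{\mathrm{del}}(\gamma,n)=\Omega(\sqrt n)$ (in the same sense, with $|T'|=n-1$).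
   Context: A string attractor of a string $T$ is a set $\Gamma$ of positions of $T$ such that every substring of $T$ has an occurrence $T[i..j]$ with $\Gamma\cap[i,j]\ne\emptyset$; $\gamma(T)$ is the minimum size of a string attractor of $T$. $\Sigma^n$ is the set of length-$n$ strings; $\mathsf{ed}$ is edit distance. For a string measure $C$: $\mathsf{MS}_{\mathrm{sub}}(C,n)=\sup\{C(T')/C(T): T\in\Sigma^n, T'\in\Sigma^n, \mathsf{ed}(T,T')=1\}$, $\mathsf{MS}_{\mathrm{ins}}$ the same with $T'\in\Sigma^{n+1}$, $\mathsf{MS}_{\mathrm{del}}$ with $T'\in\Sigma^{n-1}$; $\mathsf{AS}_{\cdot}$ analogously with $C(T')-C(T)$. -}

module Defs where

open import Data.Nat using (ℕ; zero; suc; _+_; _*_; _∸_; _^_; _≤_; _<_; _⊓_; _≡ᵇ_)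
open import Data.Bool using (if_then_else_)
open import Data.List using (List; []; _∷_; length; take; drop)
open import Data.List.Membership.Propositional using (_∈_)
open import Data.List.Relation.Unary.All using (All)
open import Data.List.Relation.Unary.Unique.Propositional using (Unique)
open import Data.Product using (_×_; ∃-syntax)
open import Relation.Binary.PropositionalEquality using (_≡_)

Str : Set
Str = List ℕ

ed : Str → Str → ℕ
ed [] ys = length ys
ed (x ∷ xs) [] = suc (length xs)
ed (x ∷ xs) (y ∷ ys) =
  (suc (ed xs (y ∷ ys)) ⊓ suc (ed (x ∷ xs) ys))
    ⊓ (ed xs ys + (if x ≡ᵇ y then 0 else 1))

-- T[i .. i+len-1] (0-based positions)
substr : Str → ℕ → ℕ → Str
substr T i len = take len (drop i T)

IsAttractor : Str → List ℕ → Set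
IsAttractor T Γ =
  Unique Γ × All (_< length T) Γ ×
  (∀ i len → 1 ≤ len → i + len ≤ length T →
     ∃[ i' ] (i' + len ≤ length T × substr T i' len ≡ substr T i len ×
              ∃[ p ] (p ∈ Γ × i' ≤ p × p < i' + len)))

γ-is : Str → ℕ → Set
γ-is T k =
  (∃[ Γ ] (IsAttractor T Γ × length Γ ≡ k)) ×
  (∀ Γ → IsAttractor T Γ → k ≤ length Γ)

data EditKind : Set where
  sub ins del : EditKind

LenOK : EditKind → ℕ → ℕ → Set
LenOK sub n m = m ≡ n
LenOK ins n m = m ≡ suc n
LenOK del n m = suc m ≡ n

EditPair : EditKind → Str → Str → Set
EditPair κ T T' = LenOK κ (length T) (length T') × ed T T' ≡ 1

-- liminf_{n→∞} MS_κ(γ,n) ≥ 2 :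
-- for every ε = 1/m there is N such that for all n ≥ N some pair T ∈ Σ^n, T'
-- with ed = 1 has γ(T')/γ(T) > 2 - 1/m  (i.e. m·γ(T') + γ(T) > 2m·γ(T)).
LiminfMS≥2 : EditKind → Set
LiminfMS≥2 κ =
  ∀ m → 1 ≤ m → ∃[ N ] ∀ n → N ≤ n →
    ∃[ T ] ∃[ T' ] (length T ≡ n × EditPair κ T T' ×
      ∃[ k ] ∃[ k' ] (γ-is T k × γ-is T' k' × 1 ≤ k ×
        2 * m * k < m * k' + k))

-- AS_κ(γ,n) ≥ γ - s and AS_κ(γ,n) = Ω(√n): there is c = 1/d > 0 such that
-- for all N, K there are T with |T| ≥ N, γ(T) ≥ K and T' with ed(T,T') = 1 and
-- γ(T') - γ(T) ≥ γ(T) - s and γ(T') - γ(T) ≥ √|T| / d.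
ASBound : EditKind → ℕ → Set
ASBound κ s =
  ∃[ d ] (1 ≤ d × ∀ N K →
    ∃[ T ] ∃[ T' ] (N ≤ length T × EditPair κ T T' ×
      ∃[ k ] ∃[ k' ] (γ-is T k × γ-is T' k' × K ≤ k ×
        2 * k ≤ k' + s × k ≤ k' × length T ≤ (d * (k' ∸ k)) ^ 2)))

-- Fix k0, let k = k0 + 2, and let B be the concatenation of k0 + 1 blocks, block m being a fresh separator
-- letter 2 + m followed by the gadget 0^(m+1) 1 0^(k-m-1). In T = 0^u 1 0^k B (u ≥ k) every gadget also
-- occurs around the lone 1 of the prefix, so the two positions u - 1, u and the separators attract T, and
-- γ(T) = k0 + 3 is simply its number of distinct letters. Substituting a fresh letter for that 1, inserting
-- a fresh letter after it, or deleting it destroys these copies: each gadget then occurs only inside its own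
-- block and needs its own attractor position, so γ jumps to 2k0 + 4 (2k0 + 3 after the deletion). The lower
-- bounds label positions so that every occurrence of a suitable window carries one label; distinct labels
-- force distinct attractor positions. As |T| = Θ(k0²), k0 = 3m gives ratios beyond 2 - 1/m, and the gain
-- k0 + O(1) is Ω(√|T|).

module Submission where

open import Defs
open import Data.Bool using (true; false; if_then_else_; T)
open import Data.Empty using (⊥-elim)
open import Data.Fin using (Fin; toℕ)
open import Data.Fin.Properties using (pigeonhole; toℕ<n)
open import Data.List using (List; []; _∷_; length; take; drop; lookup; applyUpTo; deduplicate; _++_)
open import Data.List.Properties using (length-applyUpTo; length-deduplicate; length-++; ∷-injective)
open import Data.List.Membership.Propositional using (_∈_)
open import Data.List.Membership.Propositional.Properties
  using (∈-deduplicate⁻; ∈-deduplicate⁺; ∈-applyUpTo⁺; ∈-++⁺ˡ; ∈-++⁺ʳ)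
open import Data.List.Relation.Unary.Any using (here; there; index)
open import Data.List.Relation.Unary.Any.Properties using (lookup-index)
open import Data.List.Relation.Unary.All as All using (All; []; _∷_)
open import Data.List.Relation.Unary.All.Properties using (applyUpTo⁺₁; ++⁺)
open import Data.List.Relation.Unary.Unique.Propositional using (Unique)
open import Data.List.Relation.Unary.Unique.DecPropositional.Properties using (deduplicate-!)
open import Data.Nat
open import Data.Nat.Properties
open import Data.Nat.DivMod
open import Data.Nat.Divisibility using (divides)
open import Data.Nat.Tactic.RingSolver using (solve-∀)
open import Data.Product using (_×_; _,_; ∃-syntax; proj₁; proj₂)
open import Data.Sum using (_⊎_; inj₁; inj₂)
open import Data.Unit using (tt)
open import Relation.Nullary using (yes; no; contradiction)
open import Function using (_∘_)
open import Relation.Binary.PropositionalEquality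

module _ {A : Set} where

  drop-applyUpTo : ∀ (f : ℕ → A) i n → drop i (applyUpTo f n) ≡ applyUpTo (λ t → f (i + t)) (n ∸ i)
  drop-applyUpTo f zero    n       = refl
  drop-applyUpTo f (suc i) zero    = refl
  drop-applyUpTo f (suc i) (suc n) = drop-applyUpTo (f ∘ suc) i n

  take-applyUpTo : ∀ (f : ℕ → A) {len n} → len ≤ n → take len (applyUpTo f n) ≡ applyUpTo f len
  take-applyUpTo f z≤n       = refl
  take-applyUpTo f (s≤s len≤n) = cong (f 0 ∷_) (take-applyUpTo (f ∘ suc) len≤n)

  applyUpTo-cong : ∀ {f g : ℕ → A} n → (∀ t → t < n → f t ≡ g t) → applyUpTo f n ≡ applyUpTo g n
  applyUpTo-cong zero    f≗g = refl
  applyUpTo-cong (suc n) f≗g = cong₂ _∷_ (f≗g 0 z<s) (applyUpTo-cong n (λ t t<n → f≗g (suc t) (s<s t<n)))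

  applyUpTo-injective : ∀ {f g : ℕ → A} n → applyUpTo f n ≡ applyUpTo g n → ∀ t → t < n → f t ≡ g t
  applyUpTo-injective (suc n) eq zero    _         = proj₁ (∷-injective eq)
  applyUpTo-injective (suc n) eq (suc t) (s<s t<n) = applyUpTo-injective n (proj₂ (∷-injective eq)) t t<n

  substr-applyUpTo : ∀ (f : ℕ → A) {n} i len → i + len ≤ n →
                     take len (drop i (applyUpTo f n)) ≡ applyUpTo (λ t → f (i + t)) len
  substr-applyUpTo f {n} i len i+len≤n = begin
    take len (drop i (applyUpTo f n))               ≡⟨ cong (take len) (drop-applyUpTo f i n) ⟩
    take len (applyUpTo (λ t → f (i + t)) (n ∸ i))  ≡⟨ take-applyUpTo (λ t → f (i + t)) len≤n∸i ⟩
    applyUpTo (λ t → f (i + t)) len                 ∎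
    where
    open ≡-Reasoning
    len≤n∸i : len ≤ n ∸ i
    len≤n∸i = subst (_≤ n ∸ i) (m+n∸m≡n i len) (∸-monoˡ-≤ i i+len≤n)

-- A string of length n is handled as the letter function f : ℕ → ℕ it tabulates (applyUpTo f n).

Agree : (ℕ → ℕ) → ℕ → ℕ → ℕ → Set
Agree f len i j = ∀ t → t < len → f (i + t) ≡ f (j + t)

Captured : (ℕ → ℕ) → ℕ → List ℕ → ℕ → ℕ → Set
Captured f n Γ i len =
  ∃[ i' ] (i' + len ≤ n × Agree f len i' i × ∃[ p ] (p ∈ Γ × i' ≤ p × p < i' + len))

Attracts : (ℕ → ℕ) → ℕ → List ℕ → Set
Attracts f n Γ = ∀ i len → 1 ≤ len → i + len ≤ n → Captured f n Γ i len

Agree-trans : ∀ f len i j l → Agree f len i j → Agree f len j l → Agree f len i l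
Agree-trans f len i j l i~j j~l t t<len = trans (i~j t t<len) (j~l t t<len)

captured-inside : ∀ f n Γ i len p → p ∈ Γ → i ≤ p → p < i + len → i + len ≤ n → Captured f n Γ i len
captured-inside f n Γ i len p p∈Γ i≤p p<i+len i+len≤n =
  i , i+len≤n , (λ _ _ → refl) , p , p∈Γ , i≤p , p<i+len

captured-transport : ∀ f n Γ i j len → Agree f len j i → Captured f n Γ j len → Captured f n Γ i len
captured-transport f n Γ i j len j~i (i' , bound , i'~j , hit) = i' , bound , Agree-trans f len i' j i i'~j j~i , hit

IsAttractor⇒Attracts : ∀ f n Γ → IsAttractor (applyUpTo f n) Γ → Attracts f n Γ
IsAttractor⇒Attracts f n Γ (_ , _ , attr) i len 1≤len i+len≤n
  with attr i len 1≤len (subst (i + len ≤_) (sym (length-applyUpTo f n)) i+len≤n)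
... | i' , bound , same , hit = i' , bound' , applyUpTo-injective len same' , hit
  where
  bound' = subst (i' + len ≤_) (length-applyUpTo f n) bound
  same' = trans (sym (substr-applyUpTo f i' len bound')) (trans same (substr-applyUpTo f i len i+len≤n))

Attracts⇒IsAttractor : ∀ f n Γ → Unique Γ → All (_< n) Γ → Attracts f n Γ → IsAttractor (applyUpTo f n) Γ
Attracts⇒IsAttractor f n Γ unique bounded attracts rewrite length-applyUpTo f n =
  unique , bounded , λ i len 1≤len i+len≤n →
    let (i' , bound , agree , hit) = attracts i len 1≤len i+len≤n in
    i' , bound , trans (substr-applyUpTo f i' len bound)
                   (trans (applyUpTo-cong len agree) (sym (substr-applyUpTo f i len i+len≤n))) , hit

distinct-labels≤length : ∀ (label : ℕ → ℕ) r (Γ : List ℕ) →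
  (∀ d → d < r → ∃[ p ] (p ∈ Γ × label p ≡ d)) → r ≤ length Γ
distinct-labels≤length label r Γ hit = ≮⇒≥ λ |Γ|<r →
  let (i , j , i<j , same) = pigeonhole |Γ|<r position in
  <⇒≢ i<j (trans (sym (labelled i)) (trans (cong label (same-point same)) (labelled j)))
  where
  witness : ∀ (d : Fin r) → ∃[ p ] (p ∈ Γ × label p ≡ toℕ d)
  witness d = hit (toℕ d) (toℕ<n d)
  position : Fin r → Fin (length Γ)
  position d = index (proj₁ (proj₂ (witness d)))
  point-at : ∀ d → proj₁ (witness d) ≡ lookup Γ (position d)
  point-at d = lookup-index (proj₁ (proj₂ (witness d)))
  same-point : ∀ {i j} → position i ≡ position j → proj₁ (witness i) ≡ proj₁ (witness j)
  same-point {i} {j} eq = trans (point-at i) (trans (cong (lookup Γ) eq) (sym (point-at j)))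
  labelled : ∀ d → label (proj₁ (witness d)) ≡ toℕ d
  labelled d = proj₂ (proj₂ (witness d))

-- Every occurrence of some nonempty window lies in label⁻¹(d), so an attractor must contain a
-- position labelled d.
Obligation : (ℕ → ℕ) → ℕ → (ℕ → ℕ) → ℕ → Set
Obligation f n label d = ∃[ i ] ∃[ len ] (1 ≤ len × i + len ≤ n ×
  (∀ i' → i' + len ≤ n → Agree f len i' i → ∀ x → i' ≤ x → x < i' + len → label x ≡ d))

obligations⇒≤length : ∀ f n label r → (∀ d → d < r → Obligation f n label d) →
  ∀ Γ → IsAttractor (applyUpTo f n) Γ → r ≤ length Γ
obligations⇒≤length f n label r obligation Γ attractor = distinct-labels≤length label r Γ λ d d<r →
  let (i , len , 1≤len , bound , forced) = obligation d d<r
      (i' , bound' , agree , p , p∈Γ , i'≤p , p<i'+len) = IsAttractor⇒Attracts f n Γ attractor i len 1≤len bound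
  in p , p∈Γ , forced i' bound' agree p i'≤p p<i'+len

γ-is-intro : ∀ f n K (Γ : List ℕ) → All (_< n) Γ → Attracts f n Γ → length Γ ≤ K →
  (∀ Γ' → IsAttractor (applyUpTo f n) Γ' → K ≤ length Γ') → γ-is (applyUpTo f n) K
γ-is-intro f n K Γ bounded attracts |Γ|≤K minimal =
  (Γ* , attractor , ≤-antisym (≤-trans (length-deduplicate _≟_ Γ) |Γ|≤K) (minimal Γ* attractor)) , minimal
  where
  Γ* = deduplicate _≟_ Γ
  attractor : IsAttractor (applyUpTo f n) Γ*
  attractor = Attracts⇒IsAttractor f n Γ* (deduplicate-! _≟_ Γ)
    (All.tabulate (λ p∈Γ* → All.lookup bounded (∈-deduplicate⁻ _≟_ Γ p∈Γ*)))
    λ i len 1≤len bound → let (i' , bound' , agree , p , p∈Γ , hit) = attracts i len 1≤len bound in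
      i' , bound' , agree , p , ∈-deduplicate⁺ _≟_ p∈Γ , hit

letter-obligation : ∀ f n label d i → i < n → (∀ x → x < n → f x ≡ f i → label x ≡ d) → Obligation f n label d
letter-obligation f n label d i i<n forced = i , 1 , ≤-refl , subst (_≤ n) (+-comm 1 i) i<n ,
  λ i' i'+1≤n agree x i'≤x x<i'+1 →
    let x≡i' = ≤-antisym (≤-pred (subst (x <_) (+-comm i' 1) x<i'+1)) i'≤x
        open ≡-Reasoning
    in forced x (≤-trans (s≤s (≤-reflexive x≡i')) (subst (_≤ n) (+-comm i' 1) i'+1≤n)) (begin
      f x         ≡⟨ cong f (trans x≡i' (sym (+-identityʳ i'))) ⟩
      f (i' + 0)  ≡⟨ agree 0 z<s ⟩
      f (i + 0)   ≡⟨ cong f (+-identityʳ i) ⟩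
      f i         ∎)

-- A window of a's fits into the run a^M at the start of f; shift it to end at u (or start at 0).
constant-window-captured : ∀ f n Γ a M u → u ∈ Γ → (∀ x → x < M → f x ≡ a) → u < M → M ≤ n →
  ∀ i len → 1 ≤ len → len ≤ M → (∀ t → t < len → f (i + t) ≡ a) → Captured f n Γ i len
constant-window-captured f n Γ a M u u∈Γ run u<M M≤n i len 1≤len len≤M window with len ≤? suc u
... | yes len≤1+u =
      suc u ∸ len , ≤-trans (≤-reflexive end≡) (≤-trans u<M M≤n) ,
      (λ t t<len → trans (run _ (≤-trans (+-monoʳ-< (suc u ∸ len) t<len) (≤-trans (≤-reflexive end≡) u<M)))
                         (sym (window t t<len))) ,
      u , u∈Γ , ∸-monoʳ-≤ (suc u) 1≤len , subst (u <_) (sym end≡) ≤-refl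
  where
  end≡ : suc u ∸ len + len ≡ suc u
  end≡ = m∸n+n≡m len≤1+u
... | no len≰1+u =
      0 , ≤-trans len≤M M≤n , (λ t t<len → trans (run t (<-≤-trans t<len len≤M)) (sym (window t t<len))) ,
      u , u∈Γ , z≤n , ≤-trans (n≤1+n (suc u)) (≰⇒> len≰1+u)

data Placement (x i len : ℕ) : Set where
  before : x < i → Placement x i len
  inside : i ≤ x → x < i + len → Placement x i len
  after  : i + len ≤ x → Placement x i len

placement : ∀ x i len → Placement x i len
placement x i len with x <? i | x <? i + len
... | yes x<i | _           = before x<i
... | no  x≮i | yes x<i+len = inside (≮⇒≥ x≮i) x<i+len
... | no  _   | no  x≮i+len = after (≮⇒≥ x≮i+len)

single-letter-captured : ∀ f n Γ i p → p ∈ Γ → p < n → f p ≡ f i → Captured f n Γ i 1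
single-letter-captured f n Γ i p p∈Γ p<n same =
  p , subst (_≤ n) (+-comm 1 p) p<n ,
  (λ { zero _ → trans (cong f (+-identityʳ p)) (trans same (cong f (sym (+-identityʳ i)))) ; (suc t) (s≤s ()) }) ,
  p , p∈Γ , ≤-refl , subst (p <_) (+-comm 1 p) ≤-refl

-- The prefix 0^u a 0^r with r ≤ u (u = suc u1): every window avoiding a is a window of 0^u.
lone-letter-prefix-captured : ∀ f n Γ u1 P → suc u1 < P → P ≤ n → P ≤ suc (suc u1 + suc u1) →
  (∀ x → x < P → x ≢ suc u1 → f x ≡ 0) → u1 ∈ Γ → suc u1 ∈ Γ →
  ∀ i len → 1 ≤ len → i + len ≤ P → Captured f n Γ i len
lone-letter-prefix-captured f n Γ u1 P u<P P≤n short-tail zero-elsewhere u1∈Γ u∈Γ i len 1≤len end≤P =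
  go (placement (suc u1) i len)
  where
  zeros : ∀ x → x < suc u1 → f x ≡ 0
  zeros x x<u = zero-elsewhere x (<-trans x<u u<P) (<⇒≢ x<u)
  zero-window : len ≤ suc u1 → (∀ t → t < len → f (i + t) ≡ 0) → Captured f n Γ i len
  zero-window = constant-window-captured f n Γ 0 (suc u1) u1 u1∈Γ zeros ≤-refl (≤-trans (<⇒≤ u<P) P≤n) i len 1≤len
  go : Placement (suc u1) i len → Captured f n Γ i len
  go (inside i≤u u<end) = captured-inside f n Γ i len (suc u1) u∈Γ i≤u u<end (≤-trans end≤P P≤n)
  go (after end≤u) = zero-window (≤-trans (m≤n+m len i) end≤u)
    (λ t t<len → zeros (i + t) (<-≤-trans (+-monoʳ-< i t<len) end≤u))
  go (before u<i) = zero-window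
    (+-cancelˡ-≤ (suc (suc u1)) len (suc u1) (≤-trans (+-monoˡ-≤ len u<i) (≤-trans end≤P short-tail)))
    (λ t t<len → zero-elsewhere (i + t) (<-≤-trans (+-monoʳ-< i t<len) end≤P) (>⇒≢ (<-≤-trans u<i (m≤m+n i t))))

-- The prefix 0^u a b 0^r with r ≤ u (u = suc u1), where a also occurs at p: the single-letter window a is
-- captured at p, longer windows ending at a are captured at u1.
letter-pair-prefix-captured : ∀ f n Γ u1 P p → suc (suc u1) < P → P ≤ n → P ≤ suc (suc (suc u1) + suc u1) →
  (∀ x → x < P → x ≢ suc u1 → x ≢ suc (suc u1) → f x ≡ 0) → u1 ∈ Γ → suc (suc u1) ∈ Γ →
  p ∈ Γ → p < n → f p ≡ f (suc u1) →
  ∀ i len → 1 ≤ len → i + len ≤ P → Captured f n Γ i len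
letter-pair-prefix-captured f n Γ u1 P p v<P P≤n short-tail zero-elsewhere u1∈Γ v∈Γ p∈Γ p<n same
                            i len 1≤len end≤P = go (placement (suc (suc u1)) i len)
  where
  u<P = <-trans (n<1+n (suc u1)) v<P
  zeros : ∀ x → x < suc u1 → f x ≡ 0
  zeros x x<u = zero-elsewhere x (<-trans x<u u<P) (<⇒≢ x<u) (<⇒≢ (<-trans x<u (n<1+n _)))
  zero-window : len ≤ suc u1 → (∀ t → t < len → f (i + t) ≡ 0) → Captured f n Γ i len
  zero-window = constant-window-captured f n Γ 0 (suc u1) u1 u1∈Γ zeros ≤-refl (≤-trans (<⇒≤ u<P) P≤n) i len 1≤len
  ending-at-a : ∀ l → l ≡ len → i + len ≡ suc (suc u1) → Captured f n Γ i len
  ending-at-a (suc zero) refl end≡v = single-letter-captured f n Γ i p p∈Γ p<n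
    (trans same (cong f (sym (suc-injective (trans (+-comm 1 i) end≡v)))))
  ending-at-a (suc (suc l)) refl end≡v = captured-inside f n Γ i len u1 u1∈Γ
    (subst (i ≤_) i+l≡u1 (m≤m+n i l)) (subst (u1 <_) (sym end≡v) (<-trans (n<1+n u1) (n<1+n _))) (≤-trans end≤P P≤n)
    where
    i+l≡u1 : i + l ≡ u1
    i+l≡u1 = suc-injective (suc-injective (trans (sym (trans (+-suc i (suc l)) (cong suc (+-suc i l)))) end≡v))
  go : Placement (suc (suc u1)) i len → Captured f n Γ i len
  go (inside i≤v v<end) = captured-inside f n Γ i len (suc (suc u1)) v∈Γ i≤v v<end (≤-trans end≤P P≤n)
  go (before v<i) = zero-window
    (+-cancelˡ-≤ (suc (suc (suc u1))) len (suc u1) (≤-trans (+-monoˡ-≤ len v<i) (≤-trans end≤P short-tail)))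
    (λ t t<len → zero-elsewhere (i + t) (<-≤-trans (+-monoʳ-< i t<len) end≤P)
                   (>⇒≢ (<-trans (n<1+n _) (<-≤-trans v<i (m≤m+n i t)))) (>⇒≢ (<-≤-trans v<i (m≤m+n i t))))
  go (after end≤v) with i + len ≤? suc u1
  ... | yes end≤u = zero-window (≤-trans (m≤n+m len i) end≤u)
                      (λ t t<len → zeros (i + t) (<-≤-trans (+-monoʳ-< i t<len) end≤u))
  ... | no  end≰u = ending-at-a len refl (≤-antisym end≤v (≰⇒> end≰u))

mismatch : ℕ → ℕ → ℕ
mismatch x y = if x ≡ᵇ y then 0 else 1

mismatch-refl : ∀ x → mismatch x x ≡ 0
mismatch-refl zero    = refl
mismatch-refl (suc x) = mismatch-refl x

mismatch≤1 : ∀ x y → mismatch x y ≤ 1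
mismatch≤1 x y with x ≡ᵇ y
... | true  = z≤n
... | false = ≤-refl

mismatch≡0⇒≡ : ∀ x y → mismatch x y ≡ 0 → x ≡ y
mismatch≡0⇒≡ x y eq with x ≡ᵇ y in x≡ᵇy
... | true  = ≡ᵇ⇒≡ x y (subst T (sym x≡ᵇy) tt)
... | false = contradiction (sym eq) 0≢1+n

ed-∷ : ∀ z xs ys → ed (z ∷ xs) (z ∷ ys) ≤ ed xs ys
ed-∷ z xs ys = ≤-trans (m⊓n≤n _ _) (≤-reflexive (trans (cong (ed xs ys +_) (mismatch-refl z)) (+-identityʳ _)))

ed-refl : ∀ xs → ed xs xs ≡ 0
ed-refl []       = refl
ed-refl (x ∷ xs) = n≤0⇒n≡0 (≤-trans (ed-∷ x xs xs) (≤-reflexive (ed-refl xs)))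

ed≡0⇒≡ : ∀ xs ys → ed xs ys ≡ 0 → xs ≡ ys
ed≡0⇒≡ []       []       _  = refl
ed≡0⇒≡ (x ∷ xs) (y ∷ ys) eq with ed xs ys + mismatch x y in eq'
... | zero  = cong₂ _∷_ (mismatch≡0⇒≡ x y (m+n≡0⇒n≡0 (ed xs ys) eq'))
                        (ed≡0⇒≡ xs ys (m+n≡0⇒m≡0 (ed xs ys) eq'))
... | suc _ = contradiction (sym (n≤0⇒n≡0 (≤-trans (⊓-glb (⊓-glb z<s z<s) z<s) (≤-reflexive eq)))) 0≢1+n

ed-substitute-head : ∀ x y zs → ed (x ∷ zs) (y ∷ zs) ≤ 1
ed-substitute-head x y zs =
  ≤-trans (m⊓n≤n _ _) (≤-trans (≤-reflexive (cong (_+ mismatch x y) (ed-refl zs))) (mismatch≤1 x y))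

ed-insert-head : ∀ y zs → ed zs (y ∷ zs) ≤ 1
ed-insert-head y []       = ≤-refl
ed-insert-head y (z ∷ zs) = ≤-trans (m⊓n≤m _ _) (≤-trans (m⊓n≤n _ _) (s≤s (≤-reflexive (ed-refl (z ∷ zs)))))

ed-delete-head : ∀ x zs → ed (x ∷ zs) zs ≤ 1
ed-delete-head x []       = ≤-refl
ed-delete-head x (z ∷ zs) = ≤-trans (m⊓n≤m _ _) (≤-trans (m⊓n≤m _ _) (s≤s (≤-reflexive (ed-refl (z ∷ zs)))))

ed≤1⇒≡1 : ∀ xs ys → ed xs ys ≤ 1 → xs ≢ ys → ed xs ys ≡ 1
ed≤1⇒≡1 xs ys ed≤1 xs≢ys with ed xs ys in eq
... | zero        = contradiction (ed≡0⇒≡ xs ys eq) xs≢ys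
... | suc zero    = refl
... | suc (suc _) = contradiction ed≤1 λ { (s≤s ()) }

ed-applyUpTo-substitution : ∀ f g n u → u < n → (∀ x → x ≢ u → f x ≡ g x) →
  ed (applyUpTo f n) (applyUpTo g n) ≤ 1
ed-applyUpTo-substitution f g (suc n) zero _ agree =
  subst (λ zs → ed (f 0 ∷ F) (g 0 ∷ zs) ≤ 1) (applyUpTo-cong n (λ x _ → agree (suc x) λ ()))
    (ed-substitute-head (f 0) (g 0) F)
  where F = applyUpTo (f ∘ suc) n
ed-applyUpTo-substitution f g (suc n) (suc u) (s<s u<n) agree =
  subst (λ z → ed (f 0 ∷ F) (z ∷ G) ≤ 1) (agree 0 λ ())
    (≤-trans (ed-∷ (f 0) F G) (ed-applyUpTo-substitution (f ∘ suc) (g ∘ suc) n u u<n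
      (λ x x≢u → agree (suc x) (x≢u ∘ suc-injective))))
  where
  F = applyUpTo (f ∘ suc) n
  G = applyUpTo (g ∘ suc) n

ed-applyUpTo-insertion : ∀ f g n u → u ≤ n →
  (∀ x → x < u → f x ≡ g x) → (∀ x → u ≤ x → f x ≡ g (suc x)) →
  ed (applyUpTo f n) (applyUpTo g (suc n)) ≤ 1
ed-applyUpTo-insertion f g n zero _ _ shifted =
  subst (λ zs → ed zs (g 0 ∷ G) ≤ 1) (sym (applyUpTo-cong n (λ x _ → shifted x z≤n))) (ed-insert-head (g 0) G)
  where G = applyUpTo (g ∘ suc) n
ed-applyUpTo-insertion f g (suc n) (suc u) (s≤s u≤n) same-before shifted =
  subst (λ z → ed (f 0 ∷ F) (z ∷ G) ≤ 1) (same-before 0 z<s)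
    (≤-trans (ed-∷ (f 0) F G) (ed-applyUpTo-insertion (f ∘ suc) (g ∘ suc) n u u≤n
      (λ x x<u → same-before (suc x) (s<s x<u)) (λ x u≤x → shifted (suc x) (s≤s u≤x))))
  where
  F = applyUpTo (f ∘ suc) n
  G = applyUpTo (g ∘ suc) (suc n)

ed-applyUpTo-deletion : ∀ f g n u → u ≤ n →
  (∀ x → x < u → f x ≡ g x) → (∀ x → u ≤ x → f x ≡ g (suc x)) →
  ed (applyUpTo g (suc n)) (applyUpTo f n) ≤ 1
ed-applyUpTo-deletion f g n zero _ _ shifted =
  subst (λ zs → ed (g 0 ∷ G) zs ≤ 1) (sym (applyUpTo-cong n (λ x _ → shifted x z≤n))) (ed-delete-head (g 0) G)
  where G = applyUpTo (g ∘ suc) n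
ed-applyUpTo-deletion f g (suc n) (suc u) (s≤s u≤n) same-before shifted =
  subst (λ z → ed (z ∷ G) (f 0 ∷ F) ≤ 1) (same-before 0 z<s)
    (≤-trans (ed-∷ (f 0) G F) (ed-applyUpTo-deletion (f ∘ suc) (g ∘ suc) n u u≤n
      (λ x x<u → same-before (suc x) (s<s x<u)) (λ x u≤x → shifted (suc x) (s≤s u≤x))))
  where
  F = applyUpTo (f ∘ suc) n
  G = applyUpTo (g ∘ suc) (suc n)

data ParityView : ℕ → Set where
  even : ∀ m → ParityView (m + m)
  odd  : ∀ m → ParityView (suc (m + m))

parityView : ∀ n → ParityView n
parityView zero = even 0
parityView (suc n) with parityView n
... | even m = odd m
... | odd  m = subst ParityView (cong suc (+-suc m m)) (even (suc m))

half-< : ∀ {m n} → m + m < n + n → m < n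
half-< {m} {n} m+m<n+n = ≰⇒> λ n≤m → <⇒≱ m+m<n+n (+-mono-≤ n≤m n≤m)

ifEq : ℕ → ℕ → ℕ → ℕ → ℕ
ifEq zero    zero    a b = a
ifEq (suc x) (suc y) a b = ifEq x y a b
ifEq zero    (suc y) a b = b
ifEq (suc x) zero    a b = b

ifEq-≡ : ∀ x {a b} → ifEq x x a b ≡ a
ifEq-≡ zero    = refl
ifEq-≡ (suc x) = ifEq-≡ x

ifEq-≢ : ∀ {x y} a b → x ≢ y → ifEq x y a b ≡ b
ifEq-≢ {zero}  {zero}  a b x≢y = contradiction refl x≢y
ifEq-≢ {suc x} {suc y} a b x≢y = ifEq-≢ a b (λ x≡y → x≢y (cong suc x≡y))
ifEq-≢ {zero}  {suc y} a b x≢y = refl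
ifEq-≢ {suc x} {zero}  a b x≢y = refl

ifEq-+ : ∀ w {x y a b} → ifEq (w + x) (w + y) a b ≡ ifEq x y a b
ifEq-+ zero    = refl
ifEq-+ (suc w) = ifEq-+ w

ifEq⇒≡ : ∀ x y {a b} → a ≢ b → ifEq x y a b ≡ a → x ≡ y
ifEq⇒≡ zero    zero    a≢b eq = refl
ifEq⇒≡ (suc x) (suc y) a≢b eq = cong suc (ifEq⇒≡ x y a≢b eq)
ifEq⇒≡ zero    (suc y) a≢b eq = contradiction (sym eq) a≢b
ifEq⇒≡ (suc x) zero    a≢b eq = contradiction (sym eq) a≢b

ifEq-cases : ∀ x y a b → ifEq x y a b ≡ a ⊎ ifEq x y a b ≡ b
ifEq-cases zero    zero    a b = inj₁ refl
ifEq-cases (suc x) (suc y) a b = ifEq-cases x y a b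
ifEq-cases zero    (suc y) a b = inj₂ refl
ifEq-cases (suc x) zero    a b = inj₂ refl

ifEq≤ : ∀ x y {a b c} → a ≤ c → b ≤ c → ifEq x y a b ≤ c
ifEq≤ zero    zero    a≤c b≤c = a≤c
ifEq≤ (suc x) (suc y) a≤c b≤c = ifEq≤ x y a≤c b≤c
ifEq≤ zero    (suc y) a≤c b≤c = b≤c
ifEq≤ (suc x) zero    a≤c b≤c = b≤c

join : (ℕ → ℕ) → ℕ → (ℕ → ℕ) → ℕ → ℕ
join c zero    g x       = g x
join c (suc P) g zero    = c 0
join c (suc P) g (suc x) = join (c ∘ suc) P g x

join-< : ∀ c P g {x} → x < P → join c P g x ≡ c x
join-< c (suc P) g {zero}  _         = refl
join-< c (suc P) g {suc x} (s<s x<P) = join-< (c ∘ suc) P g x<P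

join-+ : ∀ c P g y → join c P g (P + y) ≡ g y
join-+ c zero    g y = refl
join-+ c (suc P) g y = join-+ (c ∘ suc) P g y

join-cong-at : ∀ {c c'} P g x → (x < P → c x ≡ c' x) → join c P g x ≡ join c' P g x
join-cong-at zero    g x       same = refl
join-cong-at (suc P) g zero    same = same z<s
join-cong-at (suc P) g (suc x) same = join-cong-at P g x (λ x<P → same (s<s x<P))


-- Block m (m < nb) is the separator letter 2 + m followed by the gadget 0^(m+1) 1 0^(k-m-1) of
-- length k + 1; blocks concatenates the nb blocks, each of length L.
module Blocks (k0 : ℕ) where

  k L nb H : ℕ
  k  = 2 + k0
  L  = 2 + k
  nb = suc k0
  H  = 2 + k

  tile : (ℕ → ℕ → ℕ) → ℕ → ℕ
  tile b y = b (y / L) (y % L)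

  tile-at : ∀ b m {t} → t < L → tile b (m * L + t) ≡ b m t
  tile-at b m {t} t<L = cong₂ b quotient remainder
    where
    quotient : (m * L + t) / L ≡ m
    quotient = begin
      (m * L + t) / L    ≡⟨ +-distrib-/-∣ˡ t (divides m refl) ⟩
      m * L / L + t / L  ≡⟨ cong₂ _+_ (m*n/n≡m m L) (m<n⇒m/n≡0 t<L) ⟩
      m + 0              ≡⟨ +-identityʳ m ⟩
      m                  ∎
      where open ≡-Reasoning
    remainder : (m * L + t) % L ≡ t
    remainder = begin
      (m * L + t) % L  ≡⟨ cong (_% L) (+-comm (m * L) t) ⟩
      (t + m * L) % L  ≡⟨ [m+kn]%n≡m%n t m L ⟩
      t % L            ≡⟨ m<n⇒m%n≡m t<L ⟩
      t                ∎
      where open ≡-Reasoning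

  tile-view : ∀ y → ∃[ m ] ∃[ t ] (t < L × y ≡ m * L + t)
  tile-view y = y / L , y % L , m%n<n y L , trans (m≡m%n+[m/n]*n y L) (+-comm (y % L) ((y / L) * L))

  block : ℕ → ℕ → ℕ
  block m zero    = 2 + m
  block m (suc t) = ifEq t (suc m) 1 0

  blocks : ℕ → ℕ
  blocks = tile block

  blocks-separator : ∀ m → blocks (m * L) ≡ 2 + m
  blocks-separator m = trans (cong blocks (sym (+-identityʳ (m * L)))) (tile-at block m z<s)

  blocks-gadget : ∀ m {s} → s ≤ k → blocks (m * L + suc s) ≡ ifEq s (suc m) 1 0
  blocks-gadget m s≤k = tile-at block m (s≤s (s≤s s≤k))

  index<nb : ∀ {m t y} → y ≡ m * L + t → y < nb * L → m < nb
  index<nb {m} {t} refl y<nbL = *-cancelʳ-< L m nb (≤-<-trans (m≤m+n (m * L) t) y<nbL)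

  separator-unique : ∀ y m → blocks y ≡ 2 + m → y ≡ m * L
  separator-unique y m eq with tile-view y
  ... | m' , zero , _ , refl = trans (+-identityʳ (m' * L)) (cong (_* L) (suc-injective (suc-injective
                                 (trans (sym (tile-at block m' z<s)) eq))))
  ... | m' , suc t , t<L , refl = contradiction (ifEq≤ t (suc m') ≤-refl z≤n)
                                    (<⇒≱ (subst (1 <_) (sym (trans (sym (tile-at block m' t<L)) eq)) (s<s z<s)))

  window-in-blocks : ∀ y len → 1 ≤ len → y + len ≤ nb * L →
    (∃[ m ] (m < nb × y ≤ m * L × m * L < y + len)) ⊎
    (∃[ m ] ∃[ t ] (m < nb × y ≡ m * L + suc t × t + len ≤ suc k))
  window-in-blocks y len 1≤len bound with tile-view y
  ... | m , zero , _ , y≡ =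
        inj₁ (m , index<nb y≡ y<nbL , ≤-reflexive y≡' , subst (_< y + len) y≡' (m<m+n y 1≤len))
    where
    y<nbL = <-≤-trans (m<m+n y 1≤len) bound
    y≡' = trans y≡ (+-identityʳ _)
  ... | m , suc t , t<L , y≡ with suc t + len ≤? L
  ...   | yes fits = inj₂ (m , t , index<nb y≡ (<-≤-trans (m<m+n y 1≤len) bound) , y≡ , ≤-pred fits)
  ...   | no  overflows = inj₁ (suc m , *-cancelʳ-< L (suc m) nb (<-≤-trans next<end bound) , y≤next , next<end)
    where
    next<end : suc m * L < y + len
    next<end = subst (suc m * L <_) (sym (trans (cong (_+ len) y≡) (+-assoc (m * L) (suc t) len)))
                 (subst (_< m * L + (suc t + len)) (+-comm (m * L) L) (+-monoʳ-< (m * L) (≰⇒> overflows)))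
    y≤next : y ≤ suc m * L
    y≤next = subst (_≤ suc m * L) (sym y≡)
               (subst (m * L + suc t ≤_) (+-comm (m * L) L) (+-monoʳ-≤ (m * L) (<⇒≤ t<L)))

  word : (ℕ → ℕ) → ℕ → ℕ → ℕ
  word c P = join c P blocks

  word-separator : ∀ c P m → word c P (P + m * L) ≡ 2 + m
  word-separator c P m = trans (join-+ c P blocks (m * L)) (blocks-separator m)

  word-gadget : ∀ c P m t s → t + s ≤ k → word c P (P + (m * L + suc t) + s) ≡ ifEq (t + s) (suc m) 1 0
  word-gadget c P m t s t+s≤k = begin
    word c P (P + (m * L + suc t) + s)    ≡⟨ cong (word c P) (reassociate P (m * L) t s) ⟩
    word c P (P + (m * L + suc (t + s)))  ≡⟨ join-+ c P blocks _ ⟩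
    blocks (m * L + suc (t + s))          ≡⟨ blocks-gadget m t+s≤k ⟩
    ifEq (t + s) (suc m) 1 0              ∎
    where
    open ≡-Reasoning
    reassociate : ∀ P X t s → P + (X + suc t) + s ≡ P + (X + suc (t + s))
    reassociate = solve-∀

  1+index<k : ∀ {m} → m < nb → suc m < k
  1+index<k (s≤s m≤k0) = s≤s (s≤s m≤k0)

  small-window-avoids-separators : ∀ c P i len m → (∀ t → t < len → word c P (i + t) ≤ 1) →
    i ≤ P + m * L → P + m * L ≮ i + len
  small-window-avoids-separators c P i len m small i≤sep sep<end with m≤n⇒∃[o]m+o≡n i≤sep
  ... | o , i+o≡sep = contradiction (subst (_≤ 1) (trans (cong (word c P) i+o≡sep) (word-separator c P m))
                                       (small o (+-cancelˡ-< i o len (subst (_< i + len) (sym i+o≡sep) sep<end))))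
                        λ { (s≤s ()) }

  small-window : ∀ c P i len → 1 ≤ len → i + len ≤ P + nb * L → (∀ t → t < len → word c P (i + t) ≤ 1) →
    i + len ≤ P ⊎ ∃[ m ] ∃[ t ] (m < nb × i ≡ P + (m * L + suc t) × t + len ≤ suc k)
  small-window c P i len 1≤len bound small with i + len ≤? P
  ... | yes in-prefix = inj₁ in-prefix
  ... | no  ¬in-prefix with i ≤? P
  ...   | yes i≤P = contradiction (subst (_< i + len) (sym (+-identityʳ P)) (≰⇒> ¬in-prefix))
                      (small-window-avoids-separators c P i len 0 small (subst (i ≤_) (sym (+-identityʳ P)) i≤P))
  ...   | no  i≰P with m≤n⇒∃[o]m+o≡n (<⇒≤ (≰⇒> i≰P))
  ...     | y , refl with window-in-blocks y len 1≤len (+-cancelˡ-≤ P _ _ (subst (_≤ P + nb * L) (+-assoc P y len) bound))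
  ...       | inj₂ (m , t , m<nb , y≡ , fits) = inj₂ (m , t , m<nb , cong (P +_) y≡ , fits)
  ...       | inj₁ (m , _ , y≤mL , mL<y+len) =
              contradiction (subst (P + m * L <_) (sym (+-assoc P y len)) (+-monoʳ-< P mL<y+len))
                (small-window-avoids-separators c P (P + y) len m small (+-monoʳ-≤ P y≤mL))

  No10 AvoidsSeparators : (ℕ → ℕ) → ℕ → Set
  No10 c P             = ∀ x → suc x < P → c x ≡ 1 → c (suc x) ≢ 0
  AvoidsSeparators c P = ∀ x m → x < P → m < nb → c x ≢ 2 + m

  gadget-occurrence : ∀ c P → No10 c P →
    ∀ m i → m < nb → i + suc k ≤ P + nb * L → Agree (word c P) (suc k) i (P + (m * L + 1)) → i ≡ P + (m * L + 1)
  gadget-occurrence c P no-10 m i m<nb bound agree =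
    conclude (small-window c P i (suc k) z<s bound
               (λ s s<1+k → subst (_≤ 1) (sym (letter s s<1+k)) (ifEq≤ s (suc m) ≤-refl z≤n)))
    where
    letter : ∀ s → s < suc k → word c P (i + s) ≡ ifEq s (suc m) 1 0
    letter s s<1+k = trans (agree s s<1+k) (word-gadget c P m 0 s (≤-pred s<1+k))
    conclude : i + suc k ≤ P ⊎ ∃[ m' ] ∃[ t ] (m' < nb × i ≡ P + (m' * L + suc t) × t + suc k ≤ suc k) →
               i ≡ P + (m * L + 1)
    conclude (inj₁ in-prefix) = ⊥-elim (no-10 (i + suc m) next<P
      (trans (sym (join-< c P blocks (<-trans (n<1+n _) next<P)))
             (trans (letter (suc m) (s<s (<⇒≤ (1+index<k m<nb)))) (ifEq-≡ m)))
      (trans (trans (sym (join-< c P blocks next<P)) (cong (word c P) (sym (+-suc i (suc m)))))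
             (trans (letter (suc (suc m)) (s<s (1+index<k m<nb))) (ifEq-≢ 1 0 (1+n≢n {suc m})))))
      where
      next<P : suc (i + suc m) < P
      next<P = <-≤-trans (subst (_< i + suc k) (+-suc i (suc m)) (+-monoʳ-< i (s<s (1+index<k m<nb)))) in-prefix
    conclude (inj₂ (m' , zero , m'<nb , i≡ , _)) = trans i≡ (cong (λ z → P + (z * L + 1)) (suc-injective same-one))
      where
      same-one : suc m' ≡ suc m
      same-one = ifEq⇒≡ (suc m') (suc m) (λ ()) (begin
        ifEq (suc m') (suc m) 1 0            ≡⟨ sym (letter (suc m') (s<s (<⇒≤ (1+index<k m'<nb)))) ⟩
        word c P (i + suc m')                ≡⟨ cong (λ z → word c P (z + suc m')) i≡ ⟩
        word c P (P + (m' * L + 1) + suc m') ≡⟨ word-gadget c P m' 0 (suc m') (<⇒≤ (1+index<k m'<nb)) ⟩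
        ifEq (suc m') (suc m') 1 0           ≡⟨ ifEq-≡ m' ⟩
        1                                    ∎)
        where open ≡-Reasoning
    conclude (inj₂ (_ , suc t , _ , _ , fits)) = contradiction fits (<⇒≱ (m<n+m (suc k) z<s))

  within-blocks : ∀ P m t len → m < nb → t + len ≤ L → P + (m * L + t) + len ≤ P + nb * L
  within-blocks P m t len m<nb fits = begin
    P + (m * L + t) + len    ≡⟨ reassociate P (m * L) t len ⟩
    P + (m * L + (t + len))  ≤⟨ +-monoʳ-≤ P (+-monoʳ-≤ (m * L) fits) ⟩
    P + (m * L + L)          ≡⟨ cong (P +_) (+-comm (m * L) L) ⟩
    P + suc m * L            ≤⟨ +-monoʳ-≤ P (*-monoˡ-≤ L m<nb) ⟩
    P + nb * L               ∎
    where
    open ≤-Reasoning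
    reassociate : ∀ P X t len → P + (X + t) + len ≡ P + (X + (t + len))
    reassociate = solve-∀

  separator<end : ∀ P {m} → m < nb → P + m * L < P + nb * L
  separator<end P m<nb = +-monoʳ-< P (*-monoˡ-< L m<nb)

  separator-obligation : ∀ c P label d m → m < nb → (∀ x → x < P → c x ≢ 2 + m) → label (P + m * L) ≡ d →
    Obligation (word c P) (P + nb * L) label d
  separator-obligation c P label d m m<nb avoids labelled =
    letter-obligation (word c P) (P + nb * L) label d (P + m * L)
      (separator<end P m<nb) forced
    where
    forced : ∀ x → x < P + nb * L → word c P x ≡ word c P (P + m * L) → label x ≡ d
    forced x _ same with x <? P
    ... | yes x<P = contradiction (trans (sym (join-< c P blocks x<P)) (trans same (word-separator c P m))) (avoids x x<P)
    ... | no  x≮P with m≤n⇒∃[o]m+o≡n (≮⇒≥ x≮P)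
    ...   | y , refl = trans (cong (λ z → label (P + z))
                         (separator-unique y m (trans (sym (join-+ c P blocks y)) (trans same (word-separator c P m)))))
                         labelled

  fresh-letter-obligation : ∀ c P label d h → h < P → c h ≡ H → (∀ x → x < P → c x ≡ H → label x ≡ d) →
    Obligation (word c P) (P + nb * L) label d
  fresh-letter-obligation c P label d h h<P fresh labelled =
    letter-obligation (word c P) (P + nb * L) label d h (≤-trans h<P (m≤m+n P _)) forced
    where
    forced : ∀ x → x < P + nb * L → word c P x ≡ word c P h → label x ≡ d
    forced x x<n same with x <? P
    ... | yes x<P = labelled x x<P (trans (sym (join-< c P blocks x<P)) (trans same (trans (join-< c P blocks h<P) fresh)))
    ... | no  x≮P with m≤n⇒∃[o]m+o≡n (≮⇒≥ x≮P)
    ...   | y , refl = contradiction (*-cancelʳ-< L k nb (subst (_< nb * L) y≡kL (+-cancelˡ-< P y _ x<n)))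
                         (<⇒≱ (<-trans (n<1+n nb) (n<1+n k)))
      where
      y≡kL : y ≡ k * L
      y≡kL = separator-unique y k (trans (sym (join-+ c P blocks y)) (trans same (trans (join-< c P blocks h<P) fresh)))

  gadget-obligation : ∀ c P label d m → m < nb → No10 c P →
    (∀ s → s < suc k → label (P + (m * L + 1) + s) ≡ d) → Obligation (word c P) (P + nb * L) label d
  gadget-obligation c P label d m m<nb no-10 labelled =
    P + (m * L + 1) , suc k , z<s , within-blocks P m 1 (suc k) m<nb ≤-refl , forced
    where
    forced : ∀ i → i + suc k ≤ P + nb * L → Agree (word c P) (suc k) i (P + (m * L + 1)) →
             ∀ x → i ≤ x → x < i + suc k → label x ≡ d
    forced i bound agree x i≤x x<end with gadget-occurrence c P no-10 m i m<nb bound agree | m≤n⇒∃[o]m+o≡n i≤x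
    ... | refl | s , refl = labelled s (+-cancelˡ-< i s (suc k) x<end)

  gadget-one-in-run : ∀ m t → m < nb → t + k ≤ suc k → ∃[ s ] (s < k × t + s ≡ suc m)
  gadget-one-in-run m zero          m<nb _ = suc m , 1+index<k m<nb , refl
  gadget-one-in-run m (suc zero)    m<nb _ = m , <-trans (n<1+n m) (1+index<k m<nb) , refl
  gadget-one-in-run m (suc (suc t)) _    fits = ⊥-elim (<⇒≱ (≤-pred fits) (m≤n+m k t))

  zero-run-obligation : ∀ c P label d → k ≤ P → (∀ s → s < k → c s ≡ 0) →
    (∀ x → x < P → c x ≡ 0 → label x ≡ d) → Obligation (word c P) (P + nb * L) label d
  zero-run-obligation c P label d k≤P zeros labelled = 0 , k , z<s , ≤-trans k≤P (m≤m+n P _) , forced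
    where
    forced : ∀ i → i + k ≤ P + nb * L → Agree (word c P) k i 0 → ∀ x → i ≤ x → x < i + k → label x ≡ d
    forced i bound agree x i≤x x<end with m≤n⇒∃[o]m+o≡n i≤x
    ... | o , refl = conclude (small-window c P i k z<s bound (λ t t<k → subst (_≤ 1) (sym (zero-at t t<k)) z≤n))
      where
      zero-at : ∀ t → t < k → word c P (i + t) ≡ 0
      zero-at t t<k = trans (agree t t<k) (trans (join-< c P blocks (<-≤-trans t<k k≤P)) (zeros t t<k))
      o<k = +-cancelˡ-< i o k x<end
      conclude : i + k ≤ P ⊎ ∃[ m ] ∃[ t ] (m < nb × i ≡ P + (m * L + suc t) × t + k ≤ suc k) →
                 label (i + o) ≡ d
      conclude (inj₁ in-prefix) = labelled (i + o) x<P (trans (sym (join-< c P blocks x<P)) (zero-at o o<k))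
        where x<P = <-≤-trans (+-monoʳ-< i o<k) in-prefix
      conclude (inj₂ (m , t , m<nb , refl , fits)) with gadget-one-in-run m t m<nb fits
      ... | s , s<k , t+s≡1+m = contradiction (begin
        1                                    ≡⟨ sym (ifEq-≡ m) ⟩
        ifEq (suc m) (suc m) 1 0             ≡⟨ cong (λ z → ifEq z (suc m) 1 0) (sym t+s≡1+m) ⟩
        ifEq (t + s) (suc m) 1 0             ≡⟨ sym (word-gadget c P m t s (≤-pred (≤-trans (+-monoʳ-< t s<k) fits))) ⟩
        word c P (P + (m * L + suc t) + s)   ≡⟨ zero-at s s<k ⟩
        0                                    ∎) 1+n≢0
        where open ≡-Reasoning

  GadgetWindowsCaptured : (ℕ → ℕ) → ℕ → List ℕ → Set
  GadgetWindowsCaptured c P Γ = ∀ m t len → m < nb → 1 ≤ len → t + len ≤ suc k →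
    Captured (word c P) (P + nb * L) Γ (P + (m * L + suc t)) len

  word-attracts : ∀ c P Γ → (∀ m → m < nb → P + m * L ∈ Γ) →
    (∀ i len → 1 ≤ len → i + len ≤ P → Captured (word c P) (P + nb * L) Γ i len) →
    GadgetWindowsCaptured c P Γ → Attracts (word c P) (P + nb * L) Γ
  word-attracts c P Γ separators prefix gadgets i len 1≤len bound with placement P i len
  ... | inside i≤P P<end = captured-inside (word c P) _ Γ i len P (subst (_∈ Γ) (+-identityʳ P) (separators 0 z<s))
                             i≤P P<end bound
  ... | after end≤P = prefix i len 1≤len end≤P
  ... | before P<i with m≤n⇒∃[o]m+o≡n (<⇒≤ P<i)
  ...   | y , refl with window-in-blocks y len 1≤len (+-cancelˡ-≤ P _ _ (subst (_≤ P + nb * L) (+-assoc P y len) bound))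
  ...     | inj₂ (m , t , m<nb , refl , fits) = gadgets m t len m<nb 1≤len fits
  ...     | inj₁ (m , m<nb , y≤mL , mL<end) =
            captured-inside (word c P) _ Γ (P + y) len (P + m * L) (separators m m<nb) (+-monoʳ-≤ P y≤mL)
              (subst (P + m * L <_) (sym (+-assoc P y len)) (+-monoʳ-< P mL<end)) bound

  -- Γ holds every gadget's 1; windows avoiding it are runs of zeros, found in the zero prefix 0^(u1+1).
  gadget-windows-via-ones : ∀ c P Γ u1 → (∀ x → x < suc u1 → c x ≡ 0) → suc u1 ≤ P → k ≤ suc u1 →
    u1 ∈ Γ → (∀ m → m < nb → P + (m * L + suc (suc m)) ∈ Γ) → GadgetWindowsCaptured c P Γ
  gadget-windows-via-ones c P Γ u1 zeros u<P k≤u u1∈Γ ones m t len m<nb 1≤len fits = go (placement (suc m) t len)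
    where
    zero-window : len ≤ k → (∀ s → s < len → t + s ≢ suc m) →
                  Captured (word c P) (P + nb * L) Γ (P + (m * L + suc t)) len
    zero-window len≤k misses-one =
      constant-window-captured (word c P) _ Γ 0 (suc u1) u1 u1∈Γ
        (λ x x<u → trans (join-< c P blocks (<-≤-trans x<u u<P)) (zeros x x<u)) ≤-refl (≤-trans u<P (m≤m+n P _))
        _ len 1≤len (≤-trans len≤k k≤u)
        (λ s s<len → trans (word-gadget c P m t s (≤-pred (≤-trans (+-monoʳ-< t s<len) fits)))
                           (ifEq-≢ 1 0 (misses-one s s<len)))
    go : Placement (suc m) t len → Captured (word c P) (P + nb * L) Γ (P + (m * L + suc t)) len
    go (inside t≤m m<end) =
      captured-inside (word c P) _ Γ _ len _ (ones m m<nb) (+-monoʳ-≤ P (+-monoʳ-≤ (m * L) (s≤s t≤m)))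
        (subst (P + (m * L + suc (suc m)) <_) (sym (+-assoc P _ len))
          (+-monoʳ-< P (subst (m * L + suc (suc m) <_) (sym (+-assoc (m * L) (suc t) len)) (+-monoʳ-< (m * L) (s≤s m<end)))))
        (within-blocks P m (suc t) len m<nb (s≤s fits))
    go (before m<t) = zero-window (≤-pred (≤-trans (+-monoˡ-≤ len (≤-trans (s≤s z≤n) m<t)) fits))
                        (λ s _ eq → <-irrefl (sym eq) (<-≤-trans m<t (m≤m+n t s)))
    go (after end≤m) = zero-window (≤-trans (m≤n+m len t) (≤-trans end≤m (<⇒≤ (1+index<k m<nb))))
                         (λ s s<len eq → <-irrefl eq (≤-trans (+-monoʳ-< t s<len) end≤m))

  -- The prefix 0^u 1 0^k contains every gadget 0^(m+1) 1 0^(k-m-1), starting at position u - m - 1.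
  gadget-windows-via-prefix : ∀ c P Γ u → (∀ x → x < P → c x ≡ ifEq x u 1 0) → u + k < P → k ≤ u →
    (∀ i len → 1 ≤ len → i + len ≤ P → Captured (word c P) (P + nb * L) Γ i len) → GadgetWindowsCaptured c P Γ
  gadget-windows-via-prefix c P Γ u prefix-letters u+k<P k≤u prefix m t len m<nb 1≤len fits
    with m≤n⇒∃[o]m+o≡n (≤-trans (<⇒≤ (1+index<k m<nb)) k≤u)
  ... | w , refl = captured-transport (word c P) _ Γ _ (w + t) len same (prefix (w + t) len 1≤len copy-end≤P)
    where
    copy-end≤P : w + t + len ≤ P
    copy-end≤P = begin
      w + t + len      ≡⟨ +-assoc w t len ⟩
      w + (t + len)    ≤⟨ +-monoʳ-≤ w fits ⟩
      w + suc k        ≤⟨ +-monoʳ-≤ w (s≤s (m≤n+m k m)) ⟩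
      w + suc (m + k)  ≡⟨ reassociate w m k ⟩
      suc m + w + k    ≤⟨ <⇒≤ u+k<P ⟩
      P                ∎
      where
      open ≤-Reasoning
      reassociate : ∀ w m k → w + suc (m + k) ≡ suc m + w + k
      reassociate = solve-∀
    same : Agree (word c P) len (w + t) (P + (m * L + suc t))
    same s s<len = begin
      word c P (w + t + s)                ≡⟨ join-< c P blocks inside-copy ⟩
      c (w + t + s)                       ≡⟨ prefix-letters _ inside-copy ⟩
      ifEq (w + t + s) (suc m + w) 1 0     ≡⟨ cong₂ (λ x y → ifEq x y 1 0) (+-assoc w t s) (+-comm (suc m) w) ⟩
      ifEq (w + (t + s)) (w + suc m) 1 0   ≡⟨ ifEq-+ w ⟩
      ifEq (t + s) (suc m) 1 0             ≡⟨ sym (word-gadget c P m t s (≤-pred (≤-trans (+-monoʳ-< t s<len) fits))) ⟩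
      word c P (P + (m * L + suc t) + s)   ∎
      where
      open ≡-Reasoning
      inside-copy : w + t + s < P
      inside-copy = <-≤-trans (+-monoʳ-< (w + t) s<len) copy-end≤P

  blockLabel : ℕ → ℕ → ℕ
  blockLabel m zero    = m + m
  blockLabel m (suc _) = suc (m + m)

  labelling : (ℕ → ℕ) → ℕ → ℕ → ℕ → ℕ
  labelling ℓ o P = join ℓ P (λ y → o + tile blockLabel y)

  block-obligations : ∀ c P ℓ o → AvoidsSeparators c P →
    No10 c P →
    ∀ e → e < nb + nb → Obligation (word c P) (P + nb * L) (labelling ℓ o P) (o + e)
  block-obligations c P ℓ o avoids no-10 e e<2nb with parityView e
  ... | even m = separator-obligation c P (labelling ℓ o P) _ m m<nb (λ x x<P → avoids x m x<P m<nb) (begin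
    labelling ℓ o P (P + m * L)      ≡⟨ join-+ ℓ P _ (m * L) ⟩
    o + tile blockLabel (m * L)       ≡⟨ cong (λ y → o + tile blockLabel y) (sym (+-identityʳ (m * L))) ⟩
    o + tile blockLabel (m * L + 0)   ≡⟨ cong (o +_) (tile-at blockLabel m z<s) ⟩
    o + (m + m)                       ∎)
    where
    open ≡-Reasoning
    m<nb = half-< e<2nb
  ... | odd m = gadget-obligation c P (labelling ℓ o P) _ m m<nb no-10 λ s s<1+k → begin
    labelling ℓ o P (P + (m * L + 1) + s)    ≡⟨ cong (labelling ℓ o P) (reassociate P (m * L) s) ⟩
    labelling ℓ o P (P + (m * L + suc s))    ≡⟨ join-+ ℓ P _ (m * L + suc s) ⟩
    o + tile blockLabel (m * L + suc s)       ≡⟨ cong (o +_) (tile-at blockLabel m (s<s s<1+k)) ⟩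
    o + suc (m + m)                           ∎
    where
    open ≡-Reasoning
    m<nb = half-< (<-trans (n<1+n _) e<2nb)
    reassociate : ∀ P X s → P + (X + 1) + s ≡ P + (X + suc s)
    reassociate = solve-∀

  separators ones : ℕ → List ℕ
  separators P = applyUpTo (λ m → P + m * L) nb
  ones       P = applyUpTo (λ m → P + (m * L + suc (suc m))) nb

  separator∈ : ∀ P {m} → m < nb → P + m * L ∈ separators P
  separator∈ P = ∈-applyUpTo⁺ (λ m → P + m * L)

  one∈ : ∀ P {m} → m < nb → P + (m * L + suc (suc m)) ∈ ones P
  one∈ P = ∈-applyUpTo⁺ (λ m → P + (m * L + suc (suc m)))

  one<end : ∀ P {m} → m < nb → P + (m * L + suc (suc m)) < P + nb * L
  one<end P {m} m<nb = subst (_≤ P + nb * L) (+-comm _ 1)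
    (within-blocks P m (suc (suc m)) 1 m<nb (s≤s (s≤s (subst (_≤ k) (+-comm 1 m) (<⇒≤ (1+index<k m<nb))))))

  separators-bounded : ∀ P → All (_< P + nb * L) (separators P)
  separators-bounded P = applyUpTo⁺₁ (λ m → P + m * L) nb (separator<end P)

  ones-bounded : ∀ P → All (_< P + nb * L) (ones P)
  ones-bounded P = applyUpTo⁺₁ (λ m → P + (m * L + suc (suc m))) nb (one<end P)

  length-markers : ∀ P → length (separators P ++ ones P) ≡ nb + nb
  length-markers P = trans (length-++ (separators P))
    (cong₂ _+_ (length-applyUpTo (λ m → P + m * L) nb) (length-applyUpTo (λ m → P + (m * L + suc (suc m))) nb))

  edited-lower-bound : ∀ c P h → h < P → c h ≡ H → k ≤ P → (∀ s → s < k → c s ≡ 0) →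
    AvoidsSeparators c P → No10 c P →
    ∀ Γ → IsAttractor (applyUpTo (word c P) (P + nb * L)) Γ → 2 + (nb + nb) ≤ length Γ
  edited-lower-bound c P h h<P fresh k≤P zeros avoids no-10 =
    obligations⇒≤length (word c P) (P + nb * L) label (2 + (nb + nb)) obligation
    where
    isH : ℕ → ℕ
    isH x = ifEq (c x) H 0 1
    label : ℕ → ℕ
    label = labelling isH 2 P
    obligation : ∀ d → d < 2 + (nb + nb) → Obligation (word c P) (P + nb * L) label d
    obligation zero _ = fresh-letter-obligation c P label 0 h h<P fresh
      (λ x x<P cx≡H → trans (join-< isH P _ x<P) (trans (cong (λ z → ifEq z H 0 1) cx≡H) (ifEq-≡ H)))
    obligation (suc zero) _ = zero-run-obligation c P label 1 k≤P zeros
      (λ x x<P cx≡0 → trans (join-< isH P _ x<P) (cong (λ z → ifEq z H 0 1) cx≡0))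
    obligation (suc (suc e)) (s<s (s<s e<2nb)) = block-obligations c P isH 2 avoids no-10 e e<2nb

  small-or-fresh-avoids : ∀ {a} → a ≤ 1 ⊎ a ≡ H → ∀ m → m < nb → a ≢ 2 + m
  small-or-fresh-avoids (inj₁ a≤1) m _ refl = contradiction a≤1 λ { (s≤s ()) }
  small-or-fresh-avoids (inj₂ refl) m m<nb eq = <⇒≢ (<-trans m<nb (n<1+n nb)) (sym (suc-injective (suc-injective eq)))

baseLength : ℕ → ℕ
baseLength k0 = k0 * k0 + 7 * k0 + 9

-- T = 0^u 1 0^k · blocks with u = k + q; S substitutes the fresh letter H for its 1, I inserts H after it
-- and D deletes it.
module Strings (k0 q : ℕ) where
  open Blocks k0

  u u1 : ℕ
  u  = k + q
  u1 = suc (k0 + q)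

  k≤u : k ≤ u
  k≤u = m≤m+n k q

  PT PI PD nT nI nD : ℕ
  PT = suc (u + k)
  PI = suc PT
  PD = u + k
  nT = PT + nb * L
  nI = PI + nb * L
  nD = PD + nb * L

  cT cS cI cD : ℕ → ℕ
  cT x = ifEq x u 1 0
  cS x = ifEq x u H 0
  cI x = ifEq x u 1 (ifEq x (suc u) H 0)
  cD _ = 0

  fT fS fI fD : ℕ → ℕ
  fT = word cT PT
  fS = word cS PT
  fI = word cI PI
  fD = word cD PD

  u<PT : u < PT
  u<PT = s≤s (m≤m+n u k)

  PT≤nT : PT ≤ nT
  PT≤nT = m≤m+n PT (nb * L)

  u<nT : u < nT
  u<nT = <-≤-trans u<PT PT≤nT

  short-tail : PT ≤ suc (u + u)
  short-tail = s≤s (+-monoʳ-≤ u k≤u)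

  γT : γ-is (applyUpTo fT nT) (3 + k0)
  γT = γ-is-intro fT nT (3 + k0) Γ (<-trans (n<1+n u1) u<nT ∷ u<nT ∷ separators-bounded PT) attracts
         (≤-reflexive (cong (2 +_) (length-applyUpTo (λ m → PT + m * L) nb)))
         (obligations⇒≤length fT nT fT (3 + k0) obligation)
    where
    Γ = u1 ∷ u ∷ separators PT
    prefix = lone-letter-prefix-captured fT nT Γ u1 PT u<PT PT≤nT short-tail
               (λ x x<PT x≢u → trans (join-< cT PT blocks x<PT) (ifEq-≢ 1 0 x≢u)) (here refl) (there (here refl))
    attracts = word-attracts cT PT Γ (λ m m<nb → there (there (separator∈ PT m<nb))) prefix
                 (gadget-windows-via-prefix cT PT Γ u (λ _ _ → refl) ≤-refl k≤u prefix)
    obligation : ∀ d → d < 3 + k0 → Obligation fT nT fT d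
    obligation zero          _                 = letter-obligation fT nT fT 0 0 (≤-trans (s≤s z≤n) u<nT) (λ _ _ eq → eq)
    obligation (suc zero)    _                 = letter-obligation fT nT fT 1 u u<nT
      (λ _ _ eq → trans eq (trans (join-< cT PT blocks u<PT) (ifEq-≡ u)))
    obligation (suc (suc m)) (s<s (s<s m<nb)) = letter-obligation fT nT fT (2 + m) (PT + m * L) (separator<end PT m<nb)
      (λ _ _ eq → trans eq (word-separator cT PT m))

  γS : γ-is (applyUpTo fS nT) (2 + (nb + nb))
  γS = γ-is-intro fS nT _ Γ (<-trans (n<1+n u1) u<nT ∷ u<nT ∷ ++⁺ (separators-bounded PT) (ones-bounded PT)) attracts
         (≤-reflexive (cong (2 +_) (length-markers PT)))
         (edited-lower-bound cS PT u u<PT (ifEq-≡ u) (≤-trans k≤u (<⇒≤ u<PT))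
           (λ s s<k → ifEq-≢ H 0 (<⇒≢ (<-≤-trans s<k k≤u))) avoids no-10)
    where
    Γ = u1 ∷ u ∷ (separators PT ++ ones PT)
    attracts = word-attracts cS PT Γ (λ m m<nb → there (there (∈-++⁺ˡ (separator∈ PT m<nb))))
      (lone-letter-prefix-captured fS nT Γ u1 PT u<PT PT≤nT short-tail
        (λ x x<PT x≢u → trans (join-< cS PT blocks x<PT) (ifEq-≢ H 0 x≢u)) (here refl) (there (here refl)))
      (gadget-windows-via-ones cS PT Γ u1 (λ x x<u → ifEq-≢ H 0 (<⇒≢ x<u)) (<⇒≤ u<PT) k≤u (here refl)
        (λ m m<nb → there (there (∈-++⁺ʳ (separators PT) (one∈ PT m<nb)))))
    values : ∀ x → cS x ≡ H ⊎ cS x ≡ 0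
    values x = ifEq-cases x u H 0
    avoids : AvoidsSeparators cS PT
    avoids x m _ with values x
    ... | inj₁ isH = small-or-fresh-avoids (inj₂ isH) m
    ... | inj₂ is0 = small-or-fresh-avoids (inj₁ (subst (_≤ 1) (sym is0) z≤n)) m
    no-10 : No10 cS PT
    no-10 x _ is1 with values x
    ... | inj₁ isH = contradiction (trans (sym isH) is1) λ ()
    ... | inj₂ is0 = contradiction (trans (sym is0) is1) λ ()

  γI : γ-is (applyUpTo fI nI) (2 + (nb + nb))
  γI = γ-is-intro fI nI _ Γ
         (<-trans (<-trans (n<1+n u1) (n<1+n u)) v<nI ∷ v<nI ∷ ++⁺ (separators-bounded PI) (ones-bounded PI))
         attracts (≤-reflexive (cong (2 +_) (length-markers PI)))
         (edited-lower-bound cI PI (suc u) v<PI atH (≤-trans k≤u (<⇒≤ (<-trans u<PT (n<1+n PT))))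
           (λ s s<k → zeros-before s (<-≤-trans s<k k≤u)) avoids no-10)
    where
    v<PI : suc u < PI
    v<PI = s≤s u<PT
    v<nI : suc u < nI
    v<nI = <-≤-trans v<PI (m≤m+n PI (nb * L))
    atH : cI (suc u) ≡ H
    atH = trans (ifEq-≢ 1 _ (1+n≢n {u})) (ifEq-≡ (suc u))
    zeros-before : ∀ x → x < u → cI x ≡ 0
    zeros-before x x<u = trans (ifEq-≢ 1 _ (<⇒≢ x<u)) (ifEq-≢ H 0 (<⇒≢ (<-trans x<u (n<1+n u))))
    one : ℕ
    one = PI + (0 * L + 2)
    Γ = u1 ∷ suc u ∷ (separators PI ++ ones PI)
    attracts = word-attracts cI PI Γ (λ m m<nb → there (there (∈-++⁺ˡ (separator∈ PI m<nb))))
      (letter-pair-prefix-captured fI nI Γ u1 PI one v<PI (m≤m+n PI (nb * L)) (s≤s short-tail)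
        (λ x x<PI x≢u x≢v → trans (join-< cI PI blocks x<PI) (trans (ifEq-≢ 1 _ x≢u) (ifEq-≢ H 0 x≢v)))
        (here refl) (there (here refl)) (there (there (∈-++⁺ʳ (separators PI) (one∈ PI z<s)))) (one<end PI z<s)
        (trans (join-+ cI PI blocks (0 * L + 2)) (trans (blocks-gadget 0 (s≤s z≤n))
          (sym (trans (join-< cI PI blocks (<-trans (n<1+n u) v<PI)) (ifEq-≡ u))))))
      (gadget-windows-via-ones cI PI Γ u1 zeros-before (<⇒≤ (<-trans (n<1+n u) v<PI)) k≤u (here refl)
        (λ m m<nb → there (there (∈-++⁺ʳ (separators PI) (one∈ PI m<nb)))))
    avoids : AvoidsSeparators cI PI
    avoids x m _ with ifEq-cases x u 1 (ifEq x (suc u) H 0) | ifEq-cases x (suc u) H 0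
    ... | inj₁ is1 | _        = small-or-fresh-avoids (inj₁ (≤-reflexive is1)) m
    ... | inj₂ eq  | inj₁ isH = small-or-fresh-avoids (inj₂ (trans eq isH)) m
    ... | inj₂ eq  | inj₂ is0 = small-or-fresh-avoids (inj₁ (subst (_≤ 1) (sym (trans eq is0)) z≤n)) m
    no-10 : No10 cI PI
    no-10 x _ is1 with x ≟ u
    ... | yes refl = λ is0 → contradiction (trans (sym atH) is0) λ ()
    ... | no  x≢u with ifEq-cases x (suc u) H 0
    ...   | inj₁ isH = contradiction (trans (sym (trans (ifEq-≢ 1 _ x≢u) isH)) is1) λ ()
    ...   | inj₂ is0 = contradiction (trans (sym (trans (ifEq-≢ 1 _ x≢u) is0)) is1) λ ()

  γD : γ-is (applyUpTo fD nD) (1 + (nb + nb))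
  γD = γ-is-intro fD nD _ Γ
         (<-≤-trans u1<PD (m≤m+n PD (nb * L)) ∷ ++⁺ (separators-bounded PD) (ones-bounded PD)) attracts
         (≤-reflexive (cong suc (length-markers PD)))
         (obligations⇒≤length fD nD label (1 + (nb + nb)) obligation)
    where
    u1<PD : u1 < PD
    u1<PD = m≤m+n u k
    Γ = u1 ∷ (separators PD ++ ones PD)
    zeros : ∀ x → x < PD → fD x ≡ 0
    zeros x = join-< cD PD blocks
    attracts = word-attracts cD PD Γ (λ m m<nb → there (∈-++⁺ˡ (separator∈ PD m<nb)))
      (λ i len 1≤len end≤PD → constant-window-captured fD nD Γ 0 PD u1 (here refl) zeros u1<PD (m≤m+n PD (nb * L))
        i len 1≤len (≤-trans (m≤n+m len i) end≤PD)
        (λ t t<len → zeros (i + t) (<-≤-trans (+-monoʳ-< i t<len) end≤PD)))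
      (gadget-windows-via-ones cD PD Γ u1 (λ _ _ → refl) u1<PD k≤u (here refl)
        (λ m m<nb → there (∈-++⁺ʳ (separators PD) (one∈ PD m<nb))))
    label : ℕ → ℕ
    label = labelling (λ _ → 0) 1 PD
    obligation : ∀ d → d < 1 + (nb + nb) → Obligation fD nD label d
    obligation zero _ = zero-run-obligation cD PD label 0 (≤-trans k≤u u1<PD) (λ _ _ → refl)
      (λ x x<PD _ → join-< (λ _ → 0) PD _ x<PD)
    obligation (suc e) (s<s e<2nb) = block-obligations cD PD (λ _ → 0) 1 (λ _ _ _ _ ()) (λ _ _ ()) e e<2nb

  length-T : length (applyUpTo fT nT) ≡ q + baseLength k0
  length-T = trans (length-applyUpTo fT nT) (size k0 q)
    where
    size : ∀ k0 q → suc (suc (suc (k0 + q)) + (2 + k0)) + suc k0 * (2 + (2 + k0)) ≡ q + (k0 * k0 + 7 * k0 + 9)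
    size = solve-∀

  edit-sub : EditPair sub (applyUpTo fT nT) (applyUpTo fS nT)
  edit-sub = trans (length-applyUpTo fS nT) (sym (length-applyUpTo fT nT)) ,
    ed≤1⇒≡1 (applyUpTo fT nT) (applyUpTo fS nT) (ed-applyUpTo-substitution fT fS nT u u<nT
                   (λ x x≢u → join-cong-at PT blocks x (λ _ → trans (ifEq-≢ 1 0 x≢u) (sym (ifEq-≢ H 0 x≢u)))))
      λ eq → contradiction (begin
        1      ≡⟨ sym (trans (join-< cT PT blocks u<PT) (ifEq-≡ u)) ⟩
        fT u   ≡⟨ applyUpTo-injective {f = fT} {g = fS} nT eq u u<nT ⟩
        fS u   ≡⟨ trans (join-< cS PT blocks u<PT) (ifEq-≡ u) ⟩
        H      ∎) λ ()
    where open ≡-Reasoning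

  edit-ins : EditPair ins (applyUpTo fT nT) (applyUpTo fI nI)
  edit-ins = trans (length-applyUpTo fI nI) (cong suc (sym (length-applyUpTo fT nT))) ,
    ed≤1⇒≡1 (applyUpTo fT nT) (applyUpTo fI nI) (ed-applyUpTo-insertion fT fI nT (suc u) u<nT prefix-same shifted)
      λ eq → <-irrefl (trans (sym (length-applyUpTo fT nT)) (trans (cong length eq) (length-applyUpTo fI nI))) (n<1+n nT)
    where
    prefix-same : ∀ x → x < suc u → fT x ≡ fI x
    prefix-same x x≤u = trans (join-< cT PT blocks (<-≤-trans x≤u u<PT))
      (sym (trans (join-< cI PI blocks (<-≤-trans x≤u (<-trans u<PT (n<1+n PT)))) (same x x≤u)))
      where
      same : ∀ x → x < suc u → cI x ≡ cT x
      same x x≤u with x ≟ u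
      ... | yes refl = trans (ifEq-≡ u) (sym (ifEq-≡ u))
      ... | no  x≢u  = trans (ifEq-≢ 1 _ x≢u) (trans (ifEq-≢ H 0 (<⇒≢ x≤u)) (sym (ifEq-≢ 1 0 x≢u)))
    shifted : ∀ x → suc u ≤ x → fT x ≡ fI (suc x)
    shifted x u<x = join-cong-at PT blocks x λ _ →
      trans (ifEq-≢ 1 0 (>⇒≢ u<x))
        (sym (trans (ifEq-≢ 1 _ (>⇒≢ (<-trans u<x (n<1+n x)))) (ifEq-≢ H 0 (>⇒≢ (s<s u<x)))))

  edit-del : EditPair del (applyUpTo fT nT) (applyUpTo fD nD)
  edit-del = trans (cong suc (length-applyUpTo fD nD)) (sym (length-applyUpTo fT nT)) ,
    ed≤1⇒≡1 (applyUpTo fT nT) (applyUpTo fD nD)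
      (ed-applyUpTo-deletion fD fT nD u (≤-trans (m≤m+n u k) (m≤m+n PD (nb * L))) prefix-same shifted)
      λ eq → <-irrefl (sym (trans (sym (length-applyUpTo fT nT)) (trans (cong length eq) (length-applyUpTo fD nD)))) (n<1+n nD)
    where
    prefix-same : ∀ x → x < u → fD x ≡ fT x
    prefix-same x x<u = trans (join-< cD PD blocks (<-≤-trans x<u (m≤m+n u k)))
                          (sym (trans (join-< cT PT blocks (<-trans x<u u<PT)) (ifEq-≢ 1 0 (<⇒≢ x<u))))
    shifted : ∀ x → u ≤ x → fD x ≡ fT (suc x)
    shifted x u≤x = join-cong-at PD blocks x λ _ → sym (ifEq-≢ 1 0 (>⇒≢ (s≤s u≤x)))

EditFamily : EditKind → ℕ → Set
EditFamily κ e = ∀ k0 q → ∃[ T ] ∃[ T' ] (length T ≡ q + baseLength k0 × EditPair κ T T' ×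
  γ-is T (3 + k0) × γ-is T' (3 + k0 + (e + k0)))

substitution-family : EditFamily sub 1
substitution-family k0 q = _ , _ , length-T , edit-sub , γT , γS
  where open Strings k0 q

insertion-family : EditFamily ins 1
insertion-family k0 q = _ , _ , length-T , edit-ins , γT , γI
  where open Strings k0 q

deletion-family : EditFamily del 0
deletion-family k0 q = _ , _ , length-T , edit-del , γT , subst (γ-is _) (cong (λ z → 2 + z) (+-suc k0 k0)) γD
  where open Strings k0 q

-- With k0 = 3m the ratio is (6m + 3 + e) / (3m + 3) > 2 - 1/m; the padding q reaches every length n ≥ N.
liminf-from-family : ∀ κ e → EditFamily κ e → LiminfMS≥2 κ
liminf-from-family κ e family m _ = baseLength (3 * m) , λ n N≤n →
  let (T , T' , length≡ , pair , γT , γT') = family (3 * m) (n ∸ baseLength (3 * m)) in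
  T , T' , trans length≡ (m∸n+n≡m N≤n) , pair , _ , _ , γT , γT' , s≤s z≤n ,
  subst (2 * m * (3 + 3 * m) <_) (sym (expand e m)) (s≤s (m≤m+n _ _))
  where
  expand : ∀ e m → m * (3 + 3 * m + (e + 3 * m)) + (3 + 3 * m) ≡ suc (2 * m * (3 + 3 * m) + (e * m + 2))
  expand = solve-∀

baseLength-bounds : ∀ j → j ≤ baseLength (2 + j) × baseLength (2 + j) ≤ (4 * (2 + j)) ^ 2
baseLength-bounds j =
  subst (j ≤_) (sym (lower j)) (m≤m+n j _) , subst (baseLength (2 + j) ≤_) (sym (upper j)) (m≤m+n _ _)
  where
  lower : ∀ j → (2 + j) * (2 + j) + 7 * (2 + j) + 9 ≡ j + (j * j + 10 * j + 27)
  lower = solve-∀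
  upper : ∀ j → 4 * (2 + j) * (4 * (2 + j) * 1) ≡ (2 + j) * (2 + j) + 7 * (2 + j) + 9 + (15 * j * j + 53 * j + 37)
  upper = solve-∀

-- d = 4 works because |T| = baseLength k0 ≤ (4 k0)² while the gain is e + k0.
as-bound-from-family : ∀ κ s e → s + e ≡ 3 → EditFamily κ e → ASBound κ s
as-bound-from-family κ s e s+e≡3 family = 4 , s≤s z≤n , λ N K →
  let k0 = 2 + (N + K)
      (T , T' , length≡ , pair , γT , γT') = family k0 0
      (N+K≤|T| , |T|≤square) = baseLength-bounds (N + K)
      gain≡ = m+n∸m≡n (3 + k0) (e + k0)
  in T , T' , ≤-trans (m≤m+n N K) (subst (N + K ≤_) (sym length≡) N+K≤|T|) , pair , _ , _ , γT , γT' ,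
     ≤-trans (m≤n+m K N) (m≤n+m (N + K) 5) , ≤-reflexive (doubling k0) , m≤m+n (3 + k0) (e + k0) ,
     subst (_≤ (4 * (3 + k0 + (e + k0) ∸ (3 + k0))) ^ 2) (sym length≡)
       (≤-trans |T|≤square (^-monoˡ-≤ 2 (*-monoʳ-≤ 4 (subst (k0 ≤_) (sym gain≡) (m≤n+m k0 e)))))
  where
  doubling : ∀ k0 → 2 * (3 + k0) ≡ 3 + k0 + (e + k0) + s
  doubling k0 = trans (shape k0) (sym (trans (reshape k0 e s) (cong (λ z → 2 * k0 + 3 + z) s+e≡3)))
    where
    shape : ∀ k0 → 2 * (3 + k0) ≡ 2 * k0 + 3 + 3
    shape = solve-∀
    reshape : ∀ k0 e s → 3 + k0 + (e + k0) + s ≡ 2 * k0 + 3 + (s + e)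
    reshape = solve-∀

theorem3 : (LiminfMS≥2 sub × ASBound sub 2)
         × (LiminfMS≥2 ins × ASBound ins 2)
         × (LiminfMS≥2 del × ASBound del 3)
theorem3 = (liminf-from-family sub 1 substitution-family , as-bound-from-family sub 2 1 refl substitution-family)
         , (liminf-from-family ins 1 insertion-family    , as-bound-from-family ins 2 1 refl insertion-family)
         , (liminf-from-family del 0 deletion-family     , as-bound-from-family del 3 0 refl deletion-family)
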